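{- Let $G$ be a regular WRD refutation (a regular w-resolution dag whose final clause is $\Box$), and let $C$ be a clause labeling a node of $G$. (a) Suppose $C$ is derived from $C_0$ and $C_1$, with the edge from $C_0$ to $C$ labeled $\overline x$ and the edge from $C_1$ to $C$ labeled $x$. Then $\overline x\notin C_0$ and $x\notin C_1$. (b) Let $\alpha$ be an assignment such that $\alpha(l)=1$ for every literal $l$ labeling an edge on a path from (the node of) $C$ to the final clause. Then $C|_\alpha=0$, i.e. $\alpha(l)=0$ for every $l\in C$.
   Context: A literal is a variable $x$ or its negation $\overline{x}$; a clause is a finite set of literals; $\Box$ is the empty clause. An assignment $\alpha$ is a partial map from variables to $\{0,1\}$, extended to literals by $\alpha(\overline x)=1-\alpha(x)$; $C|_\alpha=0$ means $\alpha(l)=0$ for every $l\in C$. W-resolution: from arbitrary clauses $C_0,C_1$ and any variable $x$ infer $(C_0\setminus\{x\})\cup(C_1\setminus\{\overline x\})$. A WRD (w-resolution dag) proof from a set $F$ of clauses is a finite dag whose nodes are labeled by clauses, with a unique node of out-degree $0$ (the final clause); nodes of in-degree $0$ are labeled by clauses of $F$; every other node has in-degree $2$, is labeled by a variable $x$ and by the clause $(C_0\setminus\{x\})\cup(C_1\setminus\{\overline x\})$ where $C_0,C_1$ are the clauses of its two predecessors, the edge from $C_0$ being labeled $\overline x$ and the edge from $C_1$ labeled $x$. It is a refutation if the final clause is $\Box$. It is regular if for every variable $x$ every path contains at most one node labeled with $x$. -}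

module Defs where

open import Data.Nat using (ℕ)
open import Data.Bool using (Bool; true; false; not)
open import Data.Maybe using (Maybe; just; nothing)
import Data.Maybe as Maybe
open import Data.Fin using (Fin)
open import Data.List using (List; []; _∷_; length; lookup)
open import Data.List.Membership.Propositional using (_∈_)
open import Data.Product using (_×_; ∃)
open import Data.Sum using (_⊎_)
open import Relation.Nullary using (¬_)
open import Relation.Binary.PropositionalEquality using (_≡_; _≢_)

Var : Set
Var = ℕ

data Lit : Set where
  pos : Var → Lit
  neg : Var → Lit

-- A clause is a finite set of literals, represented by a list
-- (membership is what matters; order/duplicates are irrelevant).
Clause : Set
Clause = List Lit

□ : Clause
□ = []

-- Partial assignments: nothing = undefined.
Assignment : Set
Assignment = Var → Maybe Bool

value : Assignment → Lit → Maybe Bool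
value α (pos x) = α x
value α (neg x) = Maybe.map not (α x)

Falsifies : Assignment → Clause → Set
Falsifies α C = ∀ l → l ∈ C → value α l ≡ just false

IsWResolvent : Var → Clause → Clause → Clause → Set
IsWResolvent x C₀ C₁ C =
  ∀ l → (l ∈ C → ((l ∈ C₀ × l ≢ pos x) ⊎ (l ∈ C₁ × l ≢ neg x)))
      × (((l ∈ C₀ × l ≢ pos x) ⊎ (l ∈ C₁ × l ≢ neg x)) → l ∈ C)

-- Kind of a node in a dag on nodes Fin n:
--   axiom          : in-degree 0
--   wres x p₀ p₁   : in-degree 2, labeled by variable x, with predecessor
--                    p₀ (edge labeled x̄) and p₁ (edge labeled x).
data NodeKind (n : ℕ) : Set where
  axiom : NodeKind n
  wres  : Var → Fin n → Fin n → NodeKind n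

module Graph {n : ℕ} (node : Fin n → NodeKind n) where

  data Edge : Fin n → Fin n → Lit → Set where
    edge₀ : ∀ {j x p₀ p₁} → node j ≡ wres x p₀ p₁ → Edge p₀ j (neg x)
    edge₁ : ∀ {j x p₀ p₁} → node j ≡ wres x p₀ p₁ → Edge p₁ j (pos x)

  data Path : Fin n → Fin n → Set where
    []  : ∀ {u} → Path u u
    _∷_ : ∀ {u w v l} → Edge u w l → Path w v → Path u v

  pathLength : ∀ {u v} → Path u v → ℕ
  pathLength [] = 0
  pathLength (_ ∷ p) = Data.Nat.suc (pathLength p)

  vertices : ∀ {u v} → Path u v → List (Fin n)
  vertices {u} [] = u ∷ []
  vertices {u} (_ ∷ p) = u ∷ vertices p

  edgeLabels : ∀ {u v} → Path u v → List Lit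
  edgeLabels [] = []
  edgeLabels (_∷_ {l = l} _ p) = l ∷ edgeLabels p

  varOf : Fin n → Maybe Var
  varOf j with node j
  ... | axiom = nothing
  ... | wres x _ _ = just x

  Acyclic : Set
  Acyclic = ∀ u (P : Path u u) → pathLength P ≡ 0

  HasOutEdge : Fin n → Set
  HasOutEdge u = ∃ λ w → ∃ λ l → Edge u w l

  Regular : Set
  Regular = ∀ {u v} (P : Path u v) (x : Var)
              (i j : Fin (length (vertices P))) →
              varOf (lookup (vertices P) i) ≡ just x →
              varOf (lookup (vertices P) j) ≡ just x → i ≡ j

record WRD (F : List Clause) : Set where
  field
    n          : ℕ
    node       : Fin n → NodeKind n
    label      : Fin n → Clause
    final      : Fin n
  open Graph node public
  field
    acyclic     : Acyclic
    axiomLabel  : ∀ j → node j ≡ axiom → label j ∈ F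
    wresLabel   : ∀ j {x p₀ p₁} → node j ≡ wres x p₀ p₁ →
                  IsWResolvent x (label p₀) (label p₁) (label j)
    final-sink  : ¬ HasOutEdge final
    unique-sink : ∀ u → u ≢ final → HasOutEdge u

  finalClause : Clause
  finalClause = label final

IsRefutation : ∀ {F} → WRD F → Set
IsRefutation G = WRD.finalClause G ≡ □

IsRegular : ∀ {F} → WRD F → Set
IsRegular G = WRD.Regular G

-- A literal of the clause at the tail of an edge reaches the clause at its
-- head unless it is the complement of the edge literal.  Hence (b) follows
-- backwards along the path from the empty final clause: a literal of C missing
-- from the next clause is the complement of an edge literal, which α makes true.
-- For (a), a literal of x in C₀ or C₁ that is not resolved away lies in C;
-- regularity forbids any further resolution on x along a path from C to the
-- final clause, so the literal would reach □.  Such a path exists because every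
-- non-final node has an out-edge and a walk of n steps in an acyclic graph on n
-- nodes would repeat a node.
module Submission where

open import Defs
open import Data.List using (List; []; _∷_; length; lookup)
open import Data.List.Membership.Propositional using (_∈_; _∉_)
open import Data.List.Membership.Propositional.Properties using (∈-lookup)
open import Data.List.Relation.Unary.Any using (here; there; index)
open import Data.List.Relation.Unary.Any.Properties using (lookup-index)
open import Data.Product using (_×_; _,_; Σ; ∃; proj₂)
open import Data.Sum using (_⊎_; inj₁; inj₂)
open import Data.Maybe using (just; nothing)
open import Data.Bool using (true; false)
open import Data.Nat using (ℕ; zero; suc; _<_; s≤s)
open import Data.Nat.Properties using (≰⇒>; <-irrefl)
import Data.Nat.Properties as ℕ
open import Data.Fin using (Fin) renaming (zero to fzero; suc to fsuc; _<_ to _<ᶠ_)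
open import Data.Fin.Properties using (pigeonhole) renaming (_≟_ to _≟ᶠ_)
open import Data.Empty using (⊥-elim)
open import Function using (_∘_)
open import Relation.Nullary using (yes; no)
open import Relation.Nullary.Decidable using (map′)
open import Relation.Binary.Definitions using (DecidableEquality)
open import Relation.Binary.PropositionalEquality using (_≡_; _≢_; refl; sym; trans; cong; subst)

var : Lit → Var
var (pos x) = x
var (neg x) = x

complement : Lit → Lit
complement (pos x) = neg x
complement (neg x) = pos x

var-complement : ∀ l → var (complement l) ≡ var l
var-complement (pos x) = refl
var-complement (neg x) = refl

_≟ᴸ_ : DecidableEquality Lit
pos x ≟ᴸ pos y = map′ (cong pos) (λ { refl → refl }) (x ℕ.≟ y)
neg x ≟ᴸ neg y = map′ (cong neg) (λ { refl → refl }) (x ℕ.≟ y)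
pos _ ≟ᴸ neg _ = no λ ()
neg _ ≟ᴸ pos _ = no λ ()

value-complement : ∀ α l → value α l ≡ just true → value α (complement l) ≡ just false
value-complement α (pos x) αl rewrite αl = refl
value-complement α (neg x) αl with α x | αl
... | just false | _ = refl
... | just true  | ()
... | nothing    | ()

module Paths {n : ℕ} (node : Fin n → NodeKind n) where
  open Graph node

  length-vertices : ∀ {u v} (P : Path u v) → length (vertices P) ≡ suc (pathLength P)
  length-vertices []      = refl
  length-vertices (_ ∷ P) = cong suc (length-vertices P)

  head-∈-vertices : ∀ {u v} (P : Path u v) → u ∈ vertices P
  head-∈-vertices []      = here refl
  head-∈-vertices (_ ∷ _) = here refl

  prefixTo : ∀ {u v w} (P : Path u v) → w ∈ vertices P → Path u w
  prefixTo []      (here refl) = []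
  prefixTo (_ ∷ _) (here refl) = []
  prefixTo (e ∷ P) (there w∈) = e ∷ prefixTo P w∈

  module _ (acyclic : Acyclic) where

    acyclic⇒head-∉-tail : ∀ {u w v l} (e : Edge u w l) (P : Path w v) → u ∉ vertices P
    acyclic⇒head-∉-tail {u} e P u∈ with acyclic u (e ∷ prefixTo P u∈)
    ... | ()

    acyclic⇒vertices-distinct : ∀ {u v} (P : Path u v) (i j : Fin (length (vertices P))) →
                                i <ᶠ j → lookup (vertices P) i ≢ lookup (vertices P) j
    acyclic⇒vertices-distinct []      fzero    fzero    ()
    acyclic⇒vertices-distinct (e ∷ P) fzero    (fsuc j) _         u≡ =
      acyclic⇒head-∉-tail e P (subst (_∈ vertices P) (sym u≡) (∈-lookup j))
    acyclic⇒vertices-distinct (e ∷ P) (fsuc i) (fsuc j) (s≤s i<j) =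
      acyclic⇒vertices-distinct P i j i<j

    acyclic⇒pathLength<n : ∀ {u v} (P : Path u v) → pathLength P < n
    acyclic⇒pathLength<n P = ≰⇒> λ n≤len →
      let n<∣vertices∣ = subst (n <_) (sym (length-vertices P)) (s≤s n≤len)
          (i , j , i<j , same) = pigeonhole n<∣vertices∣ (lookup (vertices P))
      in acyclic⇒vertices-distinct P i j i<j same

    module _ {t : Fin n} (out : ∀ u → u ≢ t → HasOutEdge u) where

      walk : ∀ k u → Path u t ⊎ ∃ λ v → Σ (Path u v) λ P → pathLength P ≡ k
      walk zero    u = inj₂ (u , [] , refl)
      walk (suc k) u with u ≟ᶠ t
      ... | yes refl = inj₁ []
      ... | no u≢t with out u u≢t
      ...   | w , _ , e with walk k w
      ...     | inj₁ P             = inj₁ (e ∷ P)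
      ...     | inj₂ (v , P , len) = inj₂ (v , e ∷ P , cong suc len)

      path-to-sink : ∀ u → Path u t
      path-to-sink u with walk n u
      ... | inj₁ P             = P
      ... | inj₂ (_ , P , len) = ⊥-elim (<-irrefl len (acyclic⇒pathLength<n P))

  Regular⇒var-not-repeated : Regular → ∀ {u w v l x} (e : Edge u w l) (P : Path w v) →
                             varOf u ≡ just x → ∀ {z} → z ∈ vertices P → varOf z ≢ just x
  Regular⇒var-not-repeated regular {x = x} e P ux z∈ zx
    with regular (e ∷ P) x fzero (fsuc (index z∈)) ux
                 (subst (λ z → varOf z ≡ just x) (lookup-index z∈) zx)
  ... | ()

module Resolution {F : List Clause} (G : WRD F) where
  open WRD G
  open Paths node

  varOf-wres : ∀ {j x p₀ p₁} → node j ≡ wres x p₀ p₁ → varOf j ≡ just x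
  varOf-wres {j} eq with node j
  varOf-wres refl | .(wres _ _ _) = refl

  edge-varOf : ∀ {u w l} → Edge u w l → varOf w ≡ just (var l)
  edge-varOf (edge₀ eq) = varOf-wres eq
  edge-varOf (edge₁ eq) = varOf-wres eq

  edge-∈-label : ∀ {u w l m} → Edge u w l → m ∈ label u → m ∈ label w ⊎ m ≡ complement l
  edge-∈-label {m = m} (edge₀ {j} {x} eq) m∈ with m ≟ᴸ pos x
  ... | yes m≡ = inj₂ m≡
  ... | no m≢  = inj₁ (proj₂ (wresLabel j eq m) (inj₁ (m∈ , m≢)))
  edge-∈-label {m = m} (edge₁ {j} {x} eq) m∈ with m ≟ᴸ neg x
  ... | yes m≡ = inj₂ m≡
  ... | no m≢  = inj₁ (proj₂ (wresLabel j eq m) (inj₂ (m∈ , m≢)))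

  survives-edge : ∀ {u w l m} → Edge u w l → varOf w ≢ just (var m) → m ∈ label u → m ∈ label w
  survives-edge {l = l} e w≢ m∈ with edge-∈-label e m∈
  ... | inj₁ m∈w = m∈w
  ... | inj₂ refl = ⊥-elim (w≢ (trans (edge-varOf e) (cong just (sym (var-complement l)))))

  survives : ∀ {u v m} (P : Path u v) → (∀ {z} → z ∈ vertices P → varOf z ≢ just (var m)) →
             m ∈ label u → m ∈ label v
  survives []      _     m∈ = m∈
  survives (e ∷ P) avoid m∈ =
    survives P (λ z∈ → avoid (there z∈)) (survives-edge e (avoid (there (head-∈-vertices P))) m∈)

  falsified-backwards : ∀ {u v} α → Falsifies α (label v) → (P : Path u v) →
                        (∀ l → l ∈ edgeLabels P → value α l ≡ just true) → Falsifies α (label u)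
  falsified-backwards α αv []      _    = αv
  falsified-backwards α αv (_∷_ {l = l} e P) αP m m∈ with edge-∈-label e m∈
  ... | inj₁ m∈w  = falsified-backwards α αv P (λ l l∈ → αP l (there l∈)) m m∈w
  ... | inj₂ refl = value-complement α l (αP l (here refl))

  ∉-final : IsRefutation G → ∀ {m} → m ∉ label final
  ∉-final refutation m∈ with subst (_ ∈_) refutation m∈
  ... | ()

  module _ (refutation : IsRefutation G) (regular : IsRegular G) where

    own-variable-∉-label : ∀ {c m} → varOf c ≡ just (var m) → m ∉ label c
    own-variable-∉-label {c} cm m∈ with path-to-sink acyclic unique-sink c
    ... | []    = ∉-final refutation m∈
    ... | e ∷ P = ∉-final refutation (survives P avoid (survives-edge e (avoid (head-∈-vertices P)) m∈))
      where avoid = Regular⇒var-not-repeated regular e P cm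

    resolved-literals-∉-premises : ∀ c {x c₀ c₁} → node c ≡ wres x c₀ c₁ →
                                   (neg x ∉ label c₀) × (pos x ∉ label c₁)
    resolved-literals-∉-premises c {x} eq =
        (λ m∈ → own-variable-∉-label cx (proj₂ (wresLabel c eq (neg x)) (inj₁ (m∈ , λ ()))))
      , (λ m∈ → own-variable-∉-label cx (proj₂ (wresLabel c eq (pos x)) (inj₂ (m∈ , λ ()))))
      where cx = varOf-wres eq

theorem2p4 : ∀ {F : List Clause} (G : WRD F) → IsRefutation G → IsRegular G →
    let open WRD G in
    (∀ c {x c₀ c₁} → node c ≡ wres x c₀ c₁ →
        (neg x ∉ label c₀) × (pos x ∉ label c₁))
    × (∀ c (P : Path c final) (α : Assignment) →
        (∀ l → l ∈ edgeLabels P → value α l ≡ just true) →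
        Falsifies α (label c))
theorem2p4 G refutation regular =
    resolved-literals-∉-premises refutation regular
  , λ _ P α → falsified-backwards α (λ _ → ⊥-elim ∘ ∉-final refutation) P
  where open Resolution G
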